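{- Let $\mathfrak X$ be an $\ell$-variate $P$-polynomial association scheme on $\mathcal D\subset\mathbb N^\ell$ with respect to a monomial order $\le$, with adjacency matrices labeled $\{A_\alpha\}_{\alpha\in\mathcal D}$. Then for every $\alpha\in\mathbb N^\ell$, $\mathbf A^\alpha$ is a linear combination of $\{\mathbf A^\beta\mid\beta\in\mathcal D,\ \beta\le\alpha\}$.
   Context: Commutative association scheme: finite set $X$ with a partition of $X\times X$ into relations whose $0/1$ adjacency matrices satisfy $\sum A_i=J$, some $A_i=I$, closure under transpose, $A_iA_j=\sum_kp^k_{ij}A_k$, and $A_iA_j=A_jA_i$. Notation: $\mathbb N=\{0,1,\dots\}$; $\epsilon_i$ the $i$-th unit vector; $\mathbf x^{(m_1,\dots,m_\ell)}=x_1^{m_1}\cdots x_\ell^{m_\ell}$; $\mathbf A^{(m_1,\dots,m_\ell)}=A_{\epsilon_1}^{m_1}\cdots A_{\epsilon_\ell}^{m_\ell}$. A monomial order is a total well-order $\le$ on $\mathbb N^\ell$ with $\alpha\le\beta\Rightarrow\alpha+\gamma\le\beta+\gamma$; multidegree of a nonzero polynomial = its $\le$-largest exponent with nonzero coefficient. Definition: for $\mathcal D\subset\mathbb N^\ell$ containing $\epsilon_1,\dots,\epsilon_\ell$, a commutative association scheme is $\ell$-variate $P$-polynomial on $\mathcal D$ w.r.t. $\le$ if (i) whenever $(n_k)\in\mathcal D$ and $0\le m_k\le n_k$ for all $k$, $(m_k)\in\mathcal D$; (ii) its adjacency matrices are labeled bijectively $\{A_\alpha\}_{\alpha\in\mathcal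 D}$ with $A_\alpha=v_\alpha(A_{\epsilon_1},\dots,A_{\epsilon_\ell})$ for a polynomial $v_\alpha$ of multidegree $\alpha$ all of whose monomials $\mathbf x^\beta$ have $\beta\in\mathcal D$; (iii) for each $i$ and $\alpha\in\mathcal D$, $A_{\epsilon_i}\mathbf A^\alpha$ is a linear combination of $\{\mathbf A^\beta\mid\beta\in\mathcal D,\beta\le\alpha+\epsilon_i\}$. -}

module Defs where

open import Level using (Level; _⊔_) renaming (suc to lsuc)
open import Data.Nat as ℕ using (ℕ; zero; suc)
open import Data.Fin using (Fin; zero; suc)
open import Data.Fin.Properties using () renaming (_≟_ to _≟F_)
open import Data.Vec using (Vec; []; _∷_; lookup; tabulate; zipWith)
open import Data.Bool using (Bool; true; false; T; if_then_else_)
open import Data.Product using (Σ; ∃; _×_; _,_)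
open import Relation.Binary.PropositionalEquality using (_≡_; _≢_)
open import Relation.Nullary using (¬_; does)
open import Relation.Binary.Structures using (IsTotalOrder)
open import Induction.WellFounded using (WellFounded)
open import Algebra.Bundles using (CommutativeRing)

sumℕ : ∀ {n} → (Fin n → ℕ) → ℕ
sumℕ {zero}  f = 0
sumℕ {suc n} f = f zero ℕ.+ sumℕ (λ i → f (suc i))

χ : Bool → ℕ
χ true  = 1
χ false = 0

-- Commutative association scheme on X = Fin n with r relations R_0..R_{r-1}.
-- rel i x y ≡ true  iff  (x , y) ∈ R_i, i.e. the (x,y) entry of A_i is 1.

record AssociationScheme (n r : ℕ) : Set where
  field
    rel         : Fin r → Fin n → Fin n → Bool
    nonempty    : ∀ i → ∃ λ x → ∃ λ y → rel i x y ≡ true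
    partition   : ∀ x y → sumℕ (λ i → χ (rel i x y)) ≡ 1
    identity    : ∃ λ i → ∀ x y → rel i x y ≡ does (x ≟F y)
    transpose   : ∀ i → ∃ λ j → ∀ x y → rel j x y ≡ rel i y x
    -- A_i A_j = Σ_k p^k_{ij} A_k
    p           : Fin r → Fin r → Fin r → ℕ
    structure   : ∀ i j x y →
                  sumℕ (λ z → χ (rel i x z) ℕ.* χ (rel j z y))
                    ≡ sumℕ (λ k → p i j k ℕ.* χ (rel k x y))
    commutative : ∀ i j x y →
                  sumℕ (λ z → χ (rel i x z) ℕ.* χ (rel j z y))
                    ≡ sumℕ (λ z → χ (rel j x z) ℕ.* χ (rel i z y))

Exp : ℕ → Set
Exp l = Vec ℕ l

ε : ∀ {l} → Fin l → Exp l
ε i = tabulate (λ j → if does (i ≟F j) then 1 else 0)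

_⊕_ : ∀ {l} → Exp l → Exp l → Exp l
_⊕_ = zipWith ℕ._+_

record MonomialOrder (l : ℕ) : Set₁ where
  field
    _≼_          : Exp l → Exp l → Set
    isTotalOrder : IsTotalOrder _≡_ _≼_
    wellFounded  : WellFounded (λ a b → a ≼ b × a ≢ b)
    compat       : ∀ {a b} g → a ≼ b → (a ⊕ g) ≼ (b ⊕ g)

record Labeling {n r : ℕ} (𝔛 : AssociationScheme n r) (l : ℕ) (D : Exp l → Bool) : Set where
  field
    ε∈D        : ∀ k → T (D (ε k))
    downClosed : ∀ α β → T (D α) → (∀ k → lookup β k ℕ.≤ lookup α k) → T (D β)
    lab        : Fin r → Exp l
    lab∈D      : ∀ i → T (D (lab i))
    idx        : (α : Exp l) → T (D α) → Fin r
    idx-lab    : ∀ i q → idx (lab i) q ≡ i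
    lab-idx    : ∀ α q → lab (idx α q) ≡ α

module _ {c ℓ' : Level} (R : CommutativeRing c ℓ') where
  open CommutativeRing R using (Carrier; _≈_; _+_; _*_; 0#; 1#)

  Mat : ℕ → Set c
  Mat n = Fin n → Fin n → Carrier

  sumR : ∀ {n} → (Fin n → Carrier) → Carrier
  sumR {zero}  f = 0#
  sumR {suc n} f = f zero + sumR (λ i → f (suc i))

  _≋_ : ∀ {n} → Mat n → Mat n → Set ℓ'
  M ≋ N = ∀ x y → M x y ≈ N x y

  _⊗_ : ∀ {n} → Mat n → Mat n → Mat n
  (M ⊗ N) x y = sumR (λ z → M x z * N z y)

  idMat : ∀ {n} → Mat n
  idMat x y = if does (x ≟F y) then 1# else 0#

  powMat : ∀ {n} → Mat n → ℕ → Mat n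
  powMat M zero    = idMat
  powMat M (suc m) = M ⊗ powMat M m

  monoMat : ∀ {n l} → (Fin l → Mat n) → Exp l → Mat n
  monoMat B []       = idMat
  monoMat B (m ∷ ms) = powMat (B zero) m ⊗ monoMat (λ k → B (suc k)) ms

  embed : ∀ {n} → (Fin n → Fin n → Bool) → Mat n
  embed b x y = if b x y then 1# else 0#

  lincomb : ∀ {n r} → (Fin r → Carrier) → (Fin r → Mat n) → Mat n
  lincomb d M x y = sumR (λ j → d j * M j x y)

  module _ {n r l} {𝔛 : AssociationScheme n r} {D : Exp l → Bool}
           (L : Labeling 𝔛 l D) (O : MonomialOrder l) where
    open AssociationScheme 𝔛
    open Labeling L
    open MonomialOrder O

    Adj : Fin r → Mat n
    Adj i = embed (rel i)

    Aε : Fin l → Mat n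
    Aε k = Adj (idx (ε k) (ε∈D k))

    Amono : Exp l → Mat n
    Amono = monoMat Aε

    -- M is an R-linear combination of {𝐀^β | β ∈ D, β ≼ bound}
    -- (coefficient d_j belongs to 𝐀^{lab j}; it vanishes unless lab j ≼ bound)
    LinCombBelow : Mat n → Exp l → Set (c ⊔ ℓ')
    LinCombBelow M bound =
      Σ (Fin r → Carrier) λ d →
        (∀ j → ¬ (lab j ≼ bound) → d j ≈ 0#) ×
        (M ≋ lincomb d (λ j → Amono (lab j)))

  record PPolynomial {n r l} (𝔛 : AssociationScheme n r) (D : Exp l → Bool)
                     (O : MonomialOrder l) : Set (c ⊔ ℓ') where
    open AssociationScheme 𝔛
    open MonomialOrder O
    field
      labeling : Labeling 𝔛 l D
    open Labeling labeling
    field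
      -- (ii) A_{lab i} = v_{lab i}(A_{ε_1},…,A_{ε_l}),  v_{lab i} = Σ_j poly i j x^{lab j}
      -- (so all monomials of v lie in D), of multidegree lab i:
      poly         : Fin r → Fin r → Carrier
      poly-lead    : ∀ i → ¬ (poly i i ≈ 0#)
      poly-bound   : ∀ i j → ¬ (lab j ≼ lab i) → poly i j ≈ 0#
      poly-eval    : ∀ i → Adj labeling O i ≋ lincomb (poly i) (λ j → Amono labeling O (lab j))
      condIII      : ∀ k α → T (D α) →
                     LinCombBelow labeling O (Aε labeling O k ⊗ Amono labeling O α) (α ⊕ ε k)

{-# OPTIONS --safe #-}
-- Induction on the total degree of α. If α = 0 then α ∈ D (D is down-closed), so 𝐀^α
-- is itself a basis element. Otherwise write α = β + ε_k, so 𝐀^α = A_{ε_k} 𝐀^β. By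
-- induction 𝐀^β is a combination of 𝐀^γ with γ ∈ D, γ ≤ β; condition (iii) expands each
-- A_{ε_k} 𝐀^γ into 𝐀^δ with δ ≤ γ + ε_k, and γ + ε_k ≤ β + ε_k = α because the order
-- is compatible with addition.
module Submission where

open import Defs
open import Level using (Level; _⊔_)
open import Data.Nat using (ℕ; zero; suc; z≤n; _≤_; _<_)
import Data.Nat.Properties as ℕ
open import Data.Nat.Induction using (<-wellFounded)
open import Data.Bool using (Bool; T)
open import Data.Fin using (Fin; zero; suc)
open import Data.Fin.Properties using () renaming (_≟_ to _≟F_)
open import Data.Vec using (_∷_; []; lookup; tabulate; sum)
open import Data.Vec.Properties using (≡-dec)
open import Data.Product using (proj₁; proj₂; _,_)
open import Function using (_∘_)
open import Relation.Nullary using (yes; no; ¬_; contradiction)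
open import Relation.Binary using (Setoid; Decidable)
open import Relation.Binary.Consequences using (total∧dec⇒dec)
open import Relation.Binary.Structures using (IsTotalOrder)
import Relation.Binary.Construct.On as On
open import Relation.Binary.PropositionalEquality as ≡ using (_≡_)
open import Induction.WellFounded using (module All)
open import Algebra.Bundles using (CommutativeRing)

⊕-identityʳ : ∀ {l} (α : Exp l) → α ⊕ tabulate (λ _ → 0) ≡ α
⊕-identityʳ []       = ≡.refl
⊕-identityʳ (a ∷ as) = ≡.cong₂ _∷_ (ℕ.+-identityʳ a) (⊕-identityʳ as)

module _ {c ℓ' : Level} (R : CommutativeRing c ℓ') where
  open CommutativeRing R hiding (zero)
  open import Algebra.Properties.Semiring.Sum semiring
    using (sum-cong-≋; sum-replicate-zero; ∑-comm; *-distribˡ-sum)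
    renaming (sum to ∑)
  open import Algebra.Properties.CommutativeSemigroup *-commutativeSemigroup using (x∙yz≈y∙xz)
  open import Relation.Binary.Reasoning.Setoid setoid

  sumR≡∑ : ∀ {n} (f : Fin n → Carrier) → sumR R f ≡ ∑ f
  sumR≡∑ {zero}  f = ≡.refl
  sumR≡∑ {suc n} f = ≡.cong (f zero +_) (sumR≡∑ (f ∘ suc))

  sumR-cong : ∀ {n} {f g : Fin n → Carrier} → (∀ i → f i ≈ g i) → sumR R f ≈ sumR R g
  sumR-cong {f = f} {g} f≈g = begin
    sumR R f ≡⟨ sumR≡∑ f ⟩
    ∑ f      ≈⟨ sum-cong-≋ f≈g ⟩
    ∑ g      ≡⟨ sumR≡∑ g ⟨
    sumR R g ∎

  sumR-zero : ∀ {n} {f : Fin n → Carrier} → (∀ i → f i ≈ 0#) → sumR R f ≈ 0#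
  sumR-zero {n} {f} f≈0 = begin
    sumR R f         ≡⟨ sumR≡∑ f ⟩
    ∑ f              ≈⟨ sum-cong-≋ f≈0 ⟩
    ∑ {n} (λ _ → 0#) ≈⟨ sum-replicate-zero n ⟩
    0#               ∎

  *-distribˡ-sumR : ∀ {n} x (f : Fin n → Carrier) → x * sumR R f ≈ sumR R (λ i → x * f i)
  *-distribˡ-sumR x f = begin
    x * sumR R f           ≡⟨ ≡.cong (x *_) (sumR≡∑ f) ⟩
    x * ∑ f                ≈⟨ *-distribˡ-sum x f ⟩
    ∑ (λ i → x * f i)      ≡⟨ sumR≡∑ (λ i → x * f i) ⟨
    sumR R (λ i → x * f i) ∎

  *-distribʳ-sumR : ∀ {n} x (f : Fin n → Carrier) → sumR R f * x ≈ sumR R (λ i → f i * x)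
  *-distribʳ-sumR x f = begin
    sumR R f * x           ≈⟨ *-comm _ x ⟩
    x * sumR R f           ≈⟨ *-distribˡ-sumR x f ⟩
    sumR R (λ i → x * f i) ≈⟨ sumR-cong (λ i → *-comm x (f i)) ⟩
    sumR R (λ i → f i * x) ∎

  sumR-comm : ∀ {m n} (f : Fin m → Fin n → Carrier) →
              sumR R (λ i → sumR R (f i)) ≈ sumR R (λ j → sumR R (λ i → f i j))
  sumR-comm f = begin
    sumR R (λ i → sumR R (f i))         ≡⟨ sumR≡∑ (λ i → sumR R (f i)) ⟩
    ∑ (λ i → sumR R (f i))              ≈⟨ sum-cong-≋ (λ i → reflexive (sumR≡∑ (f i))) ⟩
    ∑ (λ i → ∑ (f i))                   ≈⟨ ∑-comm f ⟩
    ∑ (λ j → ∑ (λ i → f i j))           ≈⟨ sum-cong-≋ (λ j → reflexive (≡.sym (sumR≡∑ (λ i → f i j)))) ⟩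
    ∑ (λ j → sumR R (λ i → f i j))      ≡⟨ sumR≡∑ (λ j → sumR R (λ i → f i j)) ⟨
    sumR R (λ j → sumR R (λ i → f i j)) ∎

  sumR-idMat : ∀ {n} (i : Fin n) (f : Fin n → Carrier) → sumR R (λ j → idMat R i j * f j) ≈ f i
  sumR-idMat {suc n} zero f = begin
    1# * f zero + sumR R (λ j → 0# * f (suc j)) ≈⟨ +-cong (*-identityˡ _) (sumR-zero {n} (λ j → zeroˡ _)) ⟩
    f zero + 0#                                 ≈⟨ +-identityʳ _ ⟩
    f zero                                      ∎
  sumR-idMat {suc n} (suc i) f = begin
    0# * f zero + sumR R (λ j → idMat R i j * f (suc j)) ≈⟨ +-cong (zeroˡ _) (sumR-idMat i (f ∘ suc)) ⟩
    0# + f (suc i)                                       ≈⟨ +-identityˡ _ ⟩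
    f (suc i)                                            ∎

  ≋-setoid : ℕ → Setoid c ℓ'
  ≋-setoid n = record
    { Carrier       = Mat R n
    ; _≈_           = _≋_ R
    ; isEquivalence = record
      { refl  = λ x y → refl
      ; sym   = λ M≋N x y → sym (M≋N x y)
      ; trans = λ M≋N N≋K x y → trans (M≋N x y) (N≋K x y)
      }
    }

  ⊗-congˡ : ∀ {n} (K : Mat R n) {M N : Mat R n} → _≋_ R M N → _≋_ R (_⊗_ R K M) (_⊗_ R K N)
  ⊗-congˡ K M≋N x y = sumR-cong (λ z → *-congˡ (M≋N z y))

  ⊗-identityˡ : ∀ {n} (M : Mat R n) → _≋_ R (_⊗_ R (idMat R) M) M
  ⊗-identityˡ M x y = sumR-idMat x (λ z → M z y)

  ⊗-assoc : ∀ {n} (A B C : Mat R n) → _≋_ R (_⊗_ R (_⊗_ R A B) C) (_⊗_ R A (_⊗_ R B C))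
  ⊗-assoc {n} A B C x y = begin
    sumR R (λ z → sumR R (λ w → A x w * B w z) * C z y)   ≈⟨ sumR-cong {n} (λ z → *-distribʳ-sumR {n} (C z y) _) ⟩
    sumR R (λ z → sumR R (λ w → (A x w * B w z) * C z y)) ≈⟨ sumR-comm {n} {n} _ ⟩
    sumR R (λ w → sumR R (λ z → (A x w * B w z) * C z y)) ≈⟨ sumR-cong {n} (λ w → sumR-cong {n} (λ z → *-assoc _ _ _)) ⟩
    sumR R (λ w → sumR R (λ z → A x w * (B w z * C z y))) ≈⟨ sumR-cong {n} (λ w → *-distribˡ-sumR {n} (A x w) _) ⟨
    sumR R (λ w → A x w * sumR R (λ z → B w z * C z y))   ∎

  ⊗-distribˡ-lincomb : ∀ {n r} (K : Mat R n) (d : Fin r → Carrier) (M : Fin r → Mat R n) →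
                       _≋_ R (_⊗_ R K (lincomb R d M)) (lincomb R d (λ j → _⊗_ R K (M j)))
  ⊗-distribˡ-lincomb {n} {r} K d M x y = begin
    sumR R (λ z → K x z * sumR R (λ j → d j * M j z y))   ≈⟨ sumR-cong {n} (λ z → *-distribˡ-sumR {r} (K x z) _) ⟩
    sumR R (λ z → sumR R (λ j → K x z * (d j * M j z y))) ≈⟨ sumR-comm {n} {r} _ ⟩
    sumR R (λ j → sumR R (λ z → K x z * (d j * M j z y))) ≈⟨ sumR-cong {r} (λ j → sumR-cong {n} (λ z → x∙yz≈y∙xz _ _ _)) ⟩
    sumR R (λ j → sumR R (λ z → d j * (K x z * M j z y))) ≈⟨ sumR-cong {r} (λ j → *-distribˡ-sumR {n} (d j) _) ⟨
    sumR R (λ j → d j * sumR R (λ z → K x z * M j z y))   ∎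

  lincomb-congʳ : ∀ {n r} (d : Fin r → Carrier) {M N : Fin r → Mat R n} →
                  (∀ j → _≋_ R (M j) (N j)) → _≋_ R (lincomb R d M) (lincomb R d N)
  lincomb-congʳ d M≋N x y = sumR-cong (λ j → *-congˡ (M≋N j x y))

  lincomb-lincomb : ∀ {n r s} (d : Fin r → Carrier) (e : Fin r → Fin s → Carrier) (M : Fin s → Mat R n) →
                    _≋_ R (lincomb R d (λ j → lincomb R (e j) M))
                          (lincomb R (λ m → sumR R (λ j → d j * e j m)) M)
  lincomb-lincomb {n} {r} {s} d e M x y = begin
    sumR R (λ j → d j * sumR R (λ m → e j m * M m x y))   ≈⟨ sumR-cong {r} (λ j → *-distribˡ-sumR {s} (d j) _) ⟩
    sumR R (λ j → sumR R (λ m → d j * (e j m * M m x y))) ≈⟨ sumR-comm {r} {s} _ ⟩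
    sumR R (λ m → sumR R (λ j → d j * (e j m * M m x y))) ≈⟨ sumR-cong {s} (λ m → sumR-cong {r} (λ j → *-assoc _ _ _)) ⟨
    sumR R (λ m → sumR R (λ j → (d j * e j m) * M m x y)) ≈⟨ sumR-cong {s} (λ m → *-distribʳ-sumR {r} (M m x y) _) ⟨
    sumR R (λ m → sumR R (λ j → d j * e j m) * M m x y)   ∎

module _ {c ℓ' : Level} (R : CommutativeRing c ℓ') where

  data MonoMatView {n l} (B : Fin l → Mat R n) (α : Exp l) : Set (c ⊔ ℓ') where
    zero-exponent : (∀ k → lookup α k ≡ 0) → MonoMatView B α
    peel          : ∀ k β → α ≡ β ⊕ ε k → sum α ≡ suc (sum β) →
                    _≋_ R (monoMat R B α) (_⊗_ R (B k) (monoMat R B β)) → MonoMatView B α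

  monoMatView : ∀ {n l} (B : Fin l → Mat R n) (α : Exp l) → MonoMatView B α
  monoMatView B []           = zero-exponent (λ ())
  monoMatView B (suc m ∷ ms) =
    peel zero (m ∷ ms) (≡.cong₂ _∷_ (ℕ.+-comm 1 m) (≡.sym (⊕-identityʳ ms))) ≡.refl
         (⊗-assoc R (B zero) (powMat R (B zero) m) (monoMat R (B ∘ suc) ms))
  monoMatView B (zero ∷ ms) with monoMatView (B ∘ suc) ms
  ... | zero-exponent ms≡0 = zero-exponent λ { zero → ≡.refl ; (suc k) → ms≡0 k }
  ... | peel k β ms≡β⊕εk deg ms≋ =
    peel (suc k) (0 ∷ β) (≡.cong (0 ∷_) ms≡β⊕εk) deg (begin
      _⊗_ R (idMat R) (monoMat R (B ∘ suc) ms)                        ≈⟨ ⊗-identityˡ R _ ⟩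
      monoMat R (B ∘ suc) ms                                          ≈⟨ ms≋ ⟩
      _⊗_ R (B (suc k)) (monoMat R (B ∘ suc) β)                       ≈⟨ ⊗-congˡ R (B (suc k)) (⊗-identityˡ R _) ⟨
      _⊗_ R (B (suc k)) (_⊗_ R (idMat R) (monoMat R (B ∘ suc) β))     ∎)
    where open import Relation.Binary.Reasoning.Setoid (≋-setoid R _)

  module _ {n r l} {𝔛 : AssociationScheme n r} {D : Exp l → Bool}
           (L : Labeling 𝔛 l D) (O : MonomialOrder l) where
    open CommutativeRing R using (Carrier; _≈_; 0#; _*_; refl; sym; trans; reflexive; *-congˡ; *-congʳ; zeroˡ; zeroʳ)
    open Labeling L
    open MonomialOrder O
    module ≼ = IsTotalOrder isTotalOrder

    basis : Fin r → Mat R n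
    basis j = Amono R L O (lab j)

    _≼?_ : Decidable _≼_
    _≼?_ = total∧dec⇒dec ≼.reflexive ≼.antisym ≼.total (≡-dec ℕ._≟_)

    LinCombBelow-resp-≋ : ∀ {M N γ} → _≋_ R M N → LinCombBelow R L O N γ → LinCombBelow R L O M γ
    LinCombBelow-resp-≋ M≋N (d , d-vanishes , N≋) = d , d-vanishes , λ x y → trans (M≋N x y) (N≋ x y)

    Amono-LinCombBelow-self : ∀ α (α∈D : T (D α)) → LinCombBelow R L O (Amono R L O α) α
    Amono-LinCombBelow-self α α∈D = idMat R i , δ-vanishes , Amono≋
      where
      i = idx α α∈D
      δ-vanishes : ∀ j → ¬ (lab j ≼ α) → idMat R i j ≈ 0#
      δ-vanishes j lab-j⋠α with i ≟F j
      ... | yes ≡.refl = contradiction (≼.reflexive (lab-idx α α∈D)) lab-j⋠α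
      ... | no _       = refl
      Amono≋ : _≋_ R (Amono R L O α) (lincomb R (idMat R i) basis)
      Amono≋ x y = sym (trans (sumR-idMat R i (λ j → basis j x y))
                              (reflexive (≡.cong (λ β → Amono R L O β x y) (lab-idx α α∈D))))

    Aε⊗-LinCombBelow : ∀ k {M β} →
      (∀ j → LinCombBelow R L O (_⊗_ R (Aε R L O k) (basis j)) (lab j ⊕ ε k)) →
      LinCombBelow R L O M β → LinCombBelow R L O (_⊗_ R (Aε R L O k) M) (β ⊕ ε k)
    Aε⊗-LinCombBelow k {M} {β} expand (d , d-vanishes , M≋) = f , f-vanishes , Aε⊗M≋
      where
      e : Fin r → Fin r → Carrier
      e j = proj₁ (expand j)
      f : Fin r → Carrier
      f m = sumR R (λ j → d j * e j m)
      f-vanishes : ∀ m → ¬ (lab m ≼ (β ⊕ ε k)) → f m ≈ 0#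
      f-vanishes m lab-m⋠β⊕εk = sumR-zero R term-vanishes
        where
        term-vanishes : ∀ j → d j * e j m ≈ 0#
        term-vanishes j with lab j ≼? β
        ... | yes lab-j≼β = trans (*-congˡ (proj₁ (proj₂ (expand j)) m lab-m⋠lab-j⊕εk)) (zeroʳ _)
          where
          lab-m⋠lab-j⊕εk : ¬ (lab m ≼ (lab j ⊕ ε k))
          lab-m⋠lab-j⊕εk lab-m≼ = lab-m⋠β⊕εk (≼.trans lab-m≼ (compat (ε k) lab-j≼β))
        ... | no lab-j⋠β = trans (*-congʳ (d-vanishes j lab-j⋠β)) (zeroˡ _)
      Aε⊗M≋ : _≋_ R (_⊗_ R (Aε R L O k) M) (lincomb R f basis)
      Aε⊗M≋ = begin
        _⊗_ R (Aε R L O k) M                                 ≈⟨ ⊗-congˡ R _ M≋ ⟩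
        _⊗_ R (Aε R L O k) (lincomb R d basis)               ≈⟨ ⊗-distribˡ-lincomb R _ d basis ⟩
        lincomb R d (λ j → _⊗_ R (Aε R L O k) (basis j))     ≈⟨ lincomb-congʳ R d (λ j → proj₂ (proj₂ (expand j))) ⟩
        lincomb R d (λ j → lincomb R (e j) basis)            ≈⟨ lincomb-lincomb R d e basis ⟩
        lincomb R f basis                                    ∎
        where open import Relation.Binary.Reasoning.Setoid (≋-setoid R n)

    Amono-LinCombBelow :
      (∀ k α → T (D α) → LinCombBelow R L O (_⊗_ R (Aε R L O k) (Amono R L O α)) (α ⊕ ε k)) →
      ∀ α → LinCombBelow R L O (Amono R L O α) α
    Amono-LinCombBelow condIII = All.wfRec (On.wellFounded sum <-wellFounded) _ Below step
      where
      Below : Exp l → Set (c ⊔ ℓ')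
      Below α = LinCombBelow R L O (Amono R L O α) α
      step : ∀ α → (∀ {β} → sum β < sum α → Below β) → Below α
      step α ih with monoMatView (Aε R L O) α
      ... | zero-exponent α≡0 = Amono-LinCombBelow-self α (downClosed (lab i) α (lab∈D i) α≤lab-i)
        where
        i = proj₁ (AssociationScheme.identity 𝔛)
        α≤lab-i : ∀ k → lookup α k ≤ lookup (lab i) k
        α≤lab-i k = ≡.subst (_≤ lookup (lab i) k) (≡.sym (α≡0 k)) z≤n
      ... | peel k β ≡.refl deg α≋ =
        LinCombBelow-resp-≋ α≋ (Aε⊗-LinCombBelow k (λ j → condIII k (lab j) (lab∈D j))
                                                  (ih (ℕ.≤-reflexive (≡.sym deg))))

mainTheorem7 : ∀ {c ℓ' : Level} (R : CommutativeRing c ℓ') {n r l : ℕ}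
                 (𝔛 : AssociationScheme n r) (D : Exp l → Bool) (O : MonomialOrder l)
                 (P : PPolynomial R 𝔛 D O) (α : Exp l) →
                 LinCombBelow R (PPolynomial.labeling P) O
                   (Amono R (PPolynomial.labeling P) O α) α
mainTheorem7 R 𝔛 D O P = Amono-LinCombBelow R labeling O condIII
  where open PPolynomial P
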